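{- Let $X$ be a graph in the sense described in the context (loops and multiple edges allowed) which is connected, has countable vertex set, has bounded degree and has no vertex of degree one, and fix a vertex $x_0\in VX$. Then, as an identity of formal power series in $u$, \[ N(u:x_0)=(1-u^2)^{ -2}\Big[\big(1-\deg(x_0)\,u^2+(\deg(x_0)-1)\,u^4\big)\,C(u:x_0)+u^2\,(\Delta_X C(u:\cdot))(x_0)\Big], \] i.e. $N(u:x_0)=(1-u^2)^{ -2}\{1-(\deg(x_0)-\Delta_X)u^2+(\deg(x_0)-1)u^4\}C(u:\cdot)(x_0)$, where $(\Delta_X C(u:\cdot))(x_0)=\sum_{m\ge1}(\Delta_X c_m)(x_0)u^m$.
   Context: A graph $X$ consists of a vertex set $VX$ and an edge set $EX$ with maps $e\mapsto (o(e),t(e))\in VX\times VX$ and $e\mapsto \bar e$ such that $\bar e\neq e$, $\bar{\bar e}=e$, $o(e)=t(\bar e)$. For $x\in VX$, $E_x=\{e\in EX: o(e)=x\}$ and $\deg(x)=|E_x|$. A path of length $n$ is a sequence of edges $(e_1,\dots,e_n)$ with $t(e_i)=o(e_{i+1})$; $o(c)=o(e_1)$, $t(c)=t(e_n)$; a vertex is a path of length $0$. A path is closed if $o(c)=t(c)$. A path has back-tracking if $e_{i+1}=\bar e_i$ for some $i$; a geodesic is a path without back-tracking. A geodesic loop is a closed geodesic; a closed geodesic (path) is a geodesic loop with no tail, where $(e_1,\dots,e_n)$ has a tail if $e_n=\bar e_1$. For $x\in VX$ and $m\ge0$, $c_m(x)$ denotes the number of geodesic loops of length $m$ starting at $x$,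 and $N_m(x_0)$ the number of closed geodesics of length $m$ starting at $x_0$. For a function $g$ on $VX$ (not necessarily in $\ell^2$), $(\Delta_X g)(x)=\deg(x)g(x)-\sum_{e\in E_x}g(t(e))$, formally. Define the formal power series $C(u:x)=\sum_{m\ge1}c_m(x)u^m$ and $N(u:x_0)=\sum_{m\ge1}N_m(x_0)u^m$. -}

module Defs where

open import Data.Nat as ℕ using (ℕ; zero; suc; _≤_)
open import Data.Integer as ℤ using (ℤ; +_; _-_; -_)
open import Data.Bool using (Bool; true; false; _∧_; not)
open import Data.List using (List; []; _∷_; length; map; concatMap; filterᵇ; upTo; foldr)
open import Data.List.Membership.Propositional using (_∈_)
open import Data.List.Relation.Unary.Unique.Propositional using (Unique)
open import Data.Product using (Σ; ∃; _×_; _,_)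
open import Function.Definitions using (Injective)
open import Relation.Binary.Definitions using (DecidableEquality)
open import Relation.Binary.PropositionalEquality using (_≡_; _≢_; refl; cong)
open import Relation.Nullary using (yes; no; does)
open import Relation.Nullary.Decidable using (map′)

-- Since we only deal with graphs
-- of bounded degree, each E_x is finite; it is given as a duplicate-free
-- list  out x  enumerating exactly the edges with origin x.

record Graph : Set₁ where
  field
    V      : Set
    E      : Set
    o      : E → V
    t      : E → V
    bar    : E → E
    bar≢   : ∀ e → bar e ≢ e
    barbar : ∀ e → bar (bar e) ≡ e
    o≡tbar : ∀ e → o e ≡ t (bar e)
    _≟E_   : DecidableEquality E
    out    : V → List E
    out-sound    : ∀ {x e} → e ∈ out x → o e ≡ x
    out-complete : ∀ e → e ∈ out (o e)
    out-unique   : ∀ x → Unique (out x)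

  deg : V → ℕ
  deg x = length (out x)

module _ (X : Graph) where
  open Graph X

  Countable : Set
  Countable = Σ (V → ℕ) (Injective _≡_ _≡_)

  data _⇝_ : V → V → Set where
    here : ∀ {x} → x ⇝ x
    step : ∀ {y} (e : E) → t e ⇝ y → o e ⇝ y

  Connected : Set
  Connected = ∀ x y → x ⇝ y

  BoundedDegree : Set
  BoundedDegree = ∃ λ D → ∀ x → deg x ≤ D

  NoDegreeOne : Set
  NoDegreeOne = ∀ x → deg x ≢ 1

decFromInj : {A : Set} (f : A → ℕ) → Injective _≡_ _≡_ f → DecidableEquality A
decFromInj f inj x y = map′ inj (cong f) (f x ℕ.≟ f y)

module Counting (X : Graph) (_≟V_ : DecidableEquality (Graph.V X)) where
  open Graph X

  paths : ℕ → V → List (List E)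
  paths zero    x = [] ∷ []
  paths (suc m) x = concatMap (λ e → map (e ∷_) (paths m (t e))) (out x)

  endV : V → List E → V
  endV x []      = x
  endV x (e ∷ p) = endV (t e) p

  geod : List E → Bool
  geod []            = true
  geod (e ∷ [])      = true
  geod (e ∷ f ∷ p)   = not (does (f ≟E bar e)) ∧ geod (f ∷ p)

  lastE : E → List E → E
  lastE e []      = e
  lastE e (f ∷ p) = lastE f p

  hasTail : List E → Bool
  hasTail []      = false
  hasTail (e ∷ p) = does (lastE e p ≟E bar e)

  closedAt : V → List E → Bool
  closedAt x p = does (endV x p ≟V x)

  c : ℕ → V → ℕ
  c m x = length (filterᵇ (λ p → closedAt x p ∧ geod p) (paths m x))

  Ncount : ℕ → V → ℕ
  Ncount m x = length (filterᵇ (λ p → closedAt x p ∧ geod p ∧ not (hasTail p)) (paths m x))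

Series : Set
Series = ℕ → ℤ

_≈ₛ_ : Series → Series → Set
f ≈ₛ g = ∀ n → f n ≡ g n

_⊕_ : Series → Series → Series
(f ⊕ g) n = f n ℤ.+ g n

sumℤ : List ℤ → ℤ
sumℤ = foldr ℤ._+_ (+ 0)

_⊛_ : Series → Series → Series
(f ⊛ g) n = sumℤ (map (λ k → f k ℤ.* g (n ℕ.∸ k)) (upTo (suc n)))

mono : ℤ → ℕ → Series
mono a k n with n ℕ.≟ k
... | yes _ = a
... | no  _ = + 0

module PowerSeries (X : Graph) (_≟V_ : DecidableEquality (Graph.V X)) where
  open Graph X
  open Counting X _≟V_

  Cser : V → Series
  Cser x zero    = + 0
  Cser x (suc m) = + c (suc m) x

  Nser : V → Series
  Nser x zero    = + 0
  Nser x (suc m) = + Ncount (suc m) x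

  ΔC : V → Series
  ΔC x m = (+ deg x) ℤ.* Cser x m - sumℤ (map (λ e → Cser (t e) m) (out x))

  Poly : V → Series
  Poly x = mono (+ 1) 0 ⊕ (mono (- (+ deg x)) 2 ⊕ mono (+ deg x - + 1) 4)

  oneMinusU²Sq : Series
  oneMinusU²Sq = (mono (+ 1) 0 ⊕ mono (- (+ 1)) 2) ⊛ (mono (+ 1) 0 ⊕ mono (- (+ 1)) 2)

  Bracket : V → Series
  Bracket x = (Poly x ⊛ Cser x) ⊕ (mono (+ 1) 2 ⊛ ΔC x)

oneₛ : Series
oneₛ = mono (+ 1) 0

-- Let B be the non-backtracking operator on edge weights,
-- (B w)(h) = Σ { w g | o g = t h, g ≠ h̄ }. Sorting geodesics by their first edge,
-- c_{k+1}(x) = Σ_{e ∈ E_x} (Bᵏ χ_x)(e) with χ_x the indicator of the edges ending at x,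
-- and the geodesic loops of length k+1 with a tail number r_{k+1} = Σ_{e ∈ E_x} (Bᵏ δ_ē)(e),
-- so that N = C − R. Unfolding B twice, with B δ_b = χ_{o b} − δ_b̄, gives
-- (1 − u²)² R = u² (C' − 2C) − (deg x − 2) u⁴ C, where C' = Σ_{e ∈ E_x} C(u : t e);
-- this is exactly (1 − u²)² N = the bracket, and multiplying by the inverse of (1 − u²)²
-- concludes.
module Submission where

open import Defs
open import Function.Definitions using (Injective)
open import Relation.Binary.PropositionalEquality using (_≡_)
open import Data.Nat using (ℕ)
open import Data.Product using (Σ)

open import Data.Bool using (Bool; true; false; _∧_; not)
open import Data.Bool.Properties using (∧-comm; ∧-assoc)
open import Data.Empty using (⊥-elim)
open import Data.Integer using (ℤ; +_; _+_; _*_; -_; _-_)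
open import Data.Integer.Properties
  using (+-identityˡ; +-identityʳ; +-assoc; *-identityˡ; *-identityʳ; *-zeroˡ; *-zeroʳ; *-assoc; *-comm;
         *-distribˡ-+; *-distribʳ-+; neg-distrib-+)
open import Data.Integer.Tactic.RingSolver using (solve-∀)
open import Data.List using (List; []; _∷_; _++_; length; map; concatMap; filterᵇ; upTo; applyUpTo)
open import Data.List.Membership.Propositional using (_∈_; _∉_)
open import Data.List.Relation.Unary.Any using (here; there)
open import Data.List.Relation.Unary.All.Properties using (All¬⇒¬Any)
open import Data.List.Relation.Unary.AllPairs using (_∷_)
open import Data.List.Relation.Unary.Unique.Propositional using (Unique)
open import Data.Nat as ℕ using (zero; suc; _∸_; _<_; s≤s; z≤n)
open import Data.Nat.Properties using (+-∸-assoc; ≤-pred; n∸n≡0)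
open import Function using (_∘_)
open import Function.Bundles using (mk⇔)
open import Relation.Binary.Definitions using (DecidableEquality)
open import Relation.Binary.PropositionalEquality using (_≗_; _≢_; refl; sym; trans; cong; cong₂; module ≡-Reasoning; _→-setoid_)
open import Relation.Nullary using (yes; no; does)
open import Relation.Nullary.Decidable using (dec-true; dec-false; does-⇔)
import Relation.Binary.Reasoning.Setoid as SetoidReasoning

𝟙 : Bool → ℤ
𝟙 true  = + 1
𝟙 false = + 0

module _ {A : Set} where

  Σ[_] : List A → (A → ℤ) → ℤ
  Σ[ L ] f = sumℤ (map f L)

  sum-cong-∈ : ∀ (L : List A) {f g : A → ℤ} → (∀ a → a ∈ L → f a ≡ g a) → Σ[ L ] f ≡ Σ[ L ] g
  sum-cong-∈ []      f≡g = refl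
  sum-cong-∈ (a ∷ L) f≡g = cong₂ _+_ (f≡g a (here refl)) (sum-cong-∈ L (λ b b∈L → f≡g b (there b∈L)))

  sum-cong : ∀ (L : List A) {f g : A → ℤ} → f ≗ g → Σ[ L ] f ≡ Σ[ L ] g
  sum-cong L f≗g = sum-cong-∈ L (λ a _ → f≗g a)

  sum-0 : ∀ (L : List A) → Σ[ L ] (λ _ → + 0) ≡ + 0
  sum-0 []      = refl
  sum-0 (_ ∷ L) = trans (+-identityˡ _) (sum-0 L)

  sum-+ : ∀ (L : List A) (f g : A → ℤ) → Σ[ L ] (λ a → f a + g a) ≡ Σ[ L ] f + Σ[ L ] g
  sum-+ []      f g = refl
  sum-+ (a ∷ L) f g = trans (cong (_+_ (f a + g a)) (sum-+ L f g)) (interchange (f a) (g a) _ _)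
    where
    interchange : ∀ p q r s → p + q + (r + s) ≡ p + r + (q + s)
    interchange = solve-∀

  sum-neg : ∀ (L : List A) (f : A → ℤ) → Σ[ L ] (λ a → - f a) ≡ - Σ[ L ] f
  sum-neg []      f = refl
  sum-neg (a ∷ L) f = trans (cong (_+_ (- f a)) (sum-neg L f)) (sym (neg-distrib-+ (f a) _))

  sum-- : ∀ (L : List A) (f g : A → ℤ) → Σ[ L ] (λ a → f a - g a) ≡ Σ[ L ] f - Σ[ L ] g
  sum-- L f g = trans (sum-+ L f (λ a → - g a)) (cong (_+_ (Σ[ L ] f)) (sum-neg L g))

  sum-const : ∀ (L : List A) (k : ℤ) → Σ[ L ] (λ _ → k) ≡ + length L * k
  sum-const []      k = refl
  sum-const (_ ∷ L) k = trans (cong (_+_ k) (sum-const L k)) (one-more k (+ length L))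
    where
    one-more : ∀ k l → k + l * k ≡ (+ 1 + l) * k
    one-more = solve-∀

  sum-++ : ∀ (L M : List A) (f : A → ℤ) → Σ[ L ++ M ] f ≡ Σ[ L ] f + Σ[ M ] f
  sum-++ []      M f = sym (+-identityˡ _)
  sum-++ (a ∷ L) M f = trans (cong (_+_ (f a)) (sum-++ L M f)) (sym (+-assoc (f a) _ _))

  length-filterᵇ : ∀ (P : A → Bool) (L : List A) → + length (filterᵇ P L) ≡ Σ[ L ] (𝟙 ∘ P)
  length-filterᵇ P []      = refl
  length-filterᵇ P (a ∷ L) with P a
  ... | true  = cong (_+_ (+ 1)) (length-filterᵇ P L)
  ... | false = trans (length-filterᵇ P L) (sym (+-identityˡ _))

module _ {A B : Set} where

  sum-map : ∀ (L : List A) (g : A → B) (f : B → ℤ) → Σ[ map g L ] f ≡ Σ[ L ] (f ∘ g)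
  sum-map []      g f = refl
  sum-map (a ∷ L) g f = cong (_+_ (f (g a))) (sum-map L g f)

  sum-concatMap : ∀ (L : List A) (g : A → List B) (f : B → ℤ) →
    Σ[ concatMap g L ] f ≡ Σ[ L ] (λ a → Σ[ g a ] f)
  sum-concatMap []      g f = refl
  sum-concatMap (a ∷ L) g f = trans (sum-++ (g a) (concatMap g L) f) (cong (_+_ (Σ[ g a ] f)) (sum-concatMap L g f))

  sum-swap : ∀ (L : List A) (M : List B) (F : A → B → ℤ) →
    Σ[ L ] (λ a → Σ[ M ] (F a)) ≡ Σ[ M ] (λ b → Σ[ L ] (λ a → F a b))
  sum-swap []      M F = sym (sum-0 M)
  sum-swap (a ∷ L) M F = trans (cong (_+_ (Σ[ M ] (F a))) (sum-swap L M F)) (sym (sum-+ M (F a) _))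

module _ {A : Set} (_≟_ : DecidableEquality A) where

  sum-select-∉ : ∀ (L : List A) b (F : A → ℤ) → b ∉ L → Σ[ L ] (λ a → 𝟙 (does (a ≟ b)) * F a) ≡ + 0
  sum-select-∉ []      b F b∉L = refl
  sum-select-∉ (a ∷ L) b F b∉L with a ≟ b
  ... | yes refl = ⊥-elim (b∉L (here refl))
  ... | no  _    = trans (+-identityˡ _) (sum-select-∉ L b F (b∉L ∘ there))

  sum-select : ∀ (L : List A) b (F : A → ℤ) → Unique L → b ∈ L → Σ[ L ] (λ a → 𝟙 (does (a ≟ b)) * F a) ≡ F b
  sum-select (a ∷ L) b F (a∉L ∷ unique) b∈aL with a ≟ b | b∈aL
  ... | yes refl | _ = trans (cong₂ _+_ (*-identityˡ (F a)) (sum-select-∉ L a F (All¬⇒¬Any a∉L))) (+-identityʳ (F a))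
  ... | no  a≢b  | here b≡a  = ⊥-elim (a≢b (sym b≡a))
  ... | no  _    | there b∈L = trans (+-identityˡ _) (sum-select L b F unique b∈L)

module SeriesReasoning = SetoidReasoning (ℕ →-setoid ℤ)

shift : Series → Series
shift f zero    = + 0
shift f (suc n) = f n

shiftⁿ : ℕ → Series → Series
shiftⁿ zero    f = f
shiftⁿ (suc k) f = shift (shiftⁿ k f)

scale : ℤ → Series → Series
scale a f n = a * f n

shiftⁿ-cong : ∀ k {f g} → f ≈ₛ g → shiftⁿ k f ≈ₛ shiftⁿ k g
shiftⁿ-cong zero    f≈g n       = f≈g n
shiftⁿ-cong (suc k) f≈g zero    = refl
shiftⁿ-cong (suc k) f≈g (suc n) = shiftⁿ-cong k f≈g n

shiftⁿ-zipWith : ∀ (F : ℤ → ℤ → ℤ) → F (+ 0) (+ 0) ≡ + 0 → ∀ k f g →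
  shiftⁿ k (λ n → F (f n) (g n)) ≈ₛ (λ n → F (shiftⁿ k f n) (shiftⁿ k g n))
shiftⁿ-zipWith F F00 zero    f g n       = refl
shiftⁿ-zipWith F F00 (suc k) f g zero    = sym F00
shiftⁿ-zipWith F F00 (suc k) f g (suc n) = shiftⁿ-zipWith F F00 k f g n

Σ< : ℕ → (ℕ → ℤ) → ℤ
Σ< zero    F = + 0
Σ< (suc n) F = F 0 + Σ< n (F ∘ suc)

Σ<-cong : ∀ n {F G : ℕ → ℤ} → (∀ k → k < n → F k ≡ G k) → Σ< n F ≡ Σ< n G
Σ<-cong zero    F≡G = refl
Σ<-cong (suc n) F≡G = cong₂ _+_ (F≡G 0 (s≤s z≤n)) (Σ<-cong n (λ k k<n → F≡G (suc k) (s≤s k<n)))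

Σ<-0 : ∀ n → Σ< n (λ _ → + 0) ≡ + 0
Σ<-0 zero    = refl
Σ<-0 (suc n) = trans (+-identityˡ _) (Σ<-0 n)

Σ<-last : ∀ n (F : ℕ → ℤ) → Σ< (suc n) F ≡ Σ< n F + F n
Σ<-last zero    F = trans (+-identityʳ (F 0)) (sym (+-identityˡ (F 0)))
Σ<-last (suc n) F = trans (cong (_+_ (F 0)) (Σ<-last n (F ∘ suc))) (sym (+-assoc (F 0) _ _))

⊛-Σ< : ∀ f g n → (f ⊛ g) n ≡ Σ< (suc n) (λ k → f k * g (n ∸ k))
⊛-Σ< f g n = sum-applyUpTo (suc n) (λ k → k)
  where
  sum-applyUpTo : ∀ m (h : ℕ → ℕ) → sumℤ (map (λ k → f k * g (n ∸ k)) (applyUpTo h m)) ≡ Σ< m (λ k → f (h k) * g (n ∸ h k))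
  sum-applyUpTo zero    h = refl
  sum-applyUpTo (suc m) h = cong (_+_ (f (h 0) * g (n ∸ h 0))) (sum-applyUpTo m (h ∘ suc))

⊛-cong : ∀ {f f′ g g′} → f ≈ₛ f′ → g ≈ₛ g′ → (f ⊛ g) ≈ₛ (f′ ⊛ g′)
⊛-cong f≈f′ g≈g′ n = sum-cong (upTo (suc n)) (λ k → cong₂ _*_ (f≈f′ k) (g≈g′ (n ∸ k)))

⊛-identityˡ : ∀ g → (oneₛ ⊛ g) ≈ₛ g
⊛-identityˡ g n = begin
  (oneₛ ⊛ g) n                                         ≡⟨ ⊛-Σ< oneₛ g n ⟩
  + 1 * g n + Σ< n (λ k → + 0 * g (n ∸ suc k))           ≡⟨ cong₂ _+_ (*-identityˡ (g n)) (Σ<-cong n (λ k _ → *-zeroˡ (g (n ∸ suc k)))) ⟩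
  g n + Σ< n (λ _ → + 0)                               ≡⟨ cong (_+_ (g n)) (Σ<-0 n) ⟩
  g n + + 0                                            ≡⟨ +-identityʳ (g n) ⟩
  g n                                                  ∎
  where open ≡-Reasoning

⊛-distribʳ-⊕ : ∀ f g h → ((f ⊕ g) ⊛ h) ≈ₛ ((f ⊛ h) ⊕ (g ⊛ h))
⊛-distribʳ-⊕ f g h n = trans (sum-cong (upTo (suc n)) (λ k → *-distribʳ-+ (h (n ∸ k)) (f k) (g k))) (sum-+ (upTo (suc n)) (λ k → f k * h (n ∸ k)) (λ k → g k * h (n ∸ k)))

⊛-distribˡ-⊕ : ∀ f g h → (f ⊛ (g ⊕ h)) ≈ₛ ((f ⊛ g) ⊕ (f ⊛ h))
⊛-distribˡ-⊕ f g h n = trans (sum-cong (upTo (suc n)) (λ k → *-distribˡ-+ (f k) (g (n ∸ k)) (h (n ∸ k)))) (sum-+ (upTo (suc n)) (λ k → f k * g (n ∸ k)) (λ k → f k * h (n ∸ k)))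

⊛-scaleˡ : ∀ a f g → (scale a f ⊛ g) ≈ₛ scale a (f ⊛ g)
⊛-scaleˡ a f g n = trans (sum-cong (upTo (suc n)) (λ k → *-assoc a (f k) (g (n ∸ k)))) (sum-*ˡ (upTo (suc n)))
  where
  sum-*ˡ : ∀ L → Σ[ L ] (λ k → a * (f k * g (n ∸ k))) ≡ a * Σ[ L ] (λ k → f k * g (n ∸ k))
  sum-*ˡ []      = sym (*-zeroʳ a)
  sum-*ˡ (k ∷ L) = trans (cong (_+_ (a * (f k * g (n ∸ k)))) (sum-*ˡ L)) (sym (*-distribˡ-+ a _ _))

⊛-scaleʳ : ∀ a f g → (f ⊛ scale a g) ≈ₛ scale a (f ⊛ g)
⊛-scaleʳ a f g n = trans commute (⊛-scaleˡ a f g n)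
  where
  commute : (f ⊛ scale a g) n ≡ (scale a f ⊛ g) n
  commute = sum-cong (upTo (suc n)) (λ k → trans (sym (*-assoc (f k) a _)) (cong (_* g (n ∸ k)) (*-comm (f k) a)))

⊛-shiftˡ : ∀ f g → (shift f ⊛ g) ≈ₛ shift (f ⊛ g)
⊛-shiftˡ f g zero    = trans (+-identityʳ _) (*-zeroˡ (g 0))
⊛-shiftˡ f g (suc n) = trans (⊛-Σ< (shift f) g (suc n)) (trans (+-identityˡ _) (sym (⊛-Σ< f g n)))

⊛-shiftʳ : ∀ f g → (f ⊛ shift g) ≈ₛ shift (f ⊛ g)
⊛-shiftʳ f g zero    = trans (+-identityʳ _) (*-zeroʳ (f 0))
⊛-shiftʳ f g (suc n) = begin
  (f ⊛ shift g) (suc n)                                              ≡⟨ ⊛-Σ< f (shift g) (suc n) ⟩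
  Σ< (suc (suc n)) (λ k → f k * shift g (suc n ∸ k))                 ≡⟨ Σ<-last (suc n) (λ k → f k * shift g (suc n ∸ k)) ⟩
  Σ< (suc n) (λ k → f k * shift g (suc n ∸ k)) + f (suc n) * shift g (suc n ∸ suc n)
    ≡⟨ cong₂ _+_ (Σ<-cong (suc n) (λ k k<1+n → cong (λ i → f k * shift g i) (+-∸-assoc 1 (≤-pred k<1+n))))
                 (trans (cong (λ i → f (suc n) * shift g i) (n∸n≡0 n)) (*-zeroʳ (f (suc n)))) ⟩
  Σ< (suc n) (λ k → f k * g (n ∸ k)) + + 0                           ≡⟨ +-identityʳ _ ⟩
  Σ< (suc n) (λ k → f k * g (n ∸ k))                                 ≡⟨ ⊛-Σ< f g n ⟨
  (f ⊛ g) n                                                          ∎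
  where open ≡-Reasoning

⊛-shiftⁿˡ : ∀ k f g → (shiftⁿ k f ⊛ g) ≈ₛ shiftⁿ k (f ⊛ g)
⊛-shiftⁿˡ zero    f g n = refl
⊛-shiftⁿˡ (suc k) f g n = trans (⊛-shiftˡ (shiftⁿ k f) g n) (shiftⁿ-cong 1 (⊛-shiftⁿˡ k f g) n)

⊛-shiftⁿʳ : ∀ k f g → (f ⊛ shiftⁿ k g) ≈ₛ shiftⁿ k (f ⊛ g)
⊛-shiftⁿʳ zero    f g n = refl
⊛-shiftⁿʳ (suc k) f g n = trans (⊛-shiftʳ f (shiftⁿ k g) n) (shiftⁿ-cong 1 (⊛-shiftⁿʳ k f g) n)

mono≈ : ∀ a k → mono a k ≈ₛ scale a (shiftⁿ k oneₛ)
mono≈ a k n with n ℕ.≟ k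
... | yes refl = sym (trans (cong (a *_) (shiftⁿ-one-at k)) (*-identityʳ a))
  where
  shiftⁿ-one-at : ∀ k → shiftⁿ k oneₛ k ≡ + 1
  shiftⁿ-one-at zero    = refl
  shiftⁿ-one-at (suc k) = shiftⁿ-one-at k
... | no n≢k = sym (trans (cong (a *_) (shiftⁿ-one-off k n n≢k)) (*-zeroʳ a))
  where
  shiftⁿ-one-off : ∀ k n → n ≢ k → shiftⁿ k oneₛ n ≡ + 0
  shiftⁿ-one-off zero    zero    n≢k = ⊥-elim (n≢k refl)
  shiftⁿ-one-off zero    (suc n) n≢k = refl
  shiftⁿ-one-off (suc k) zero    n≢k = refl
  shiftⁿ-one-off (suc k) (suc n) n≢k = shiftⁿ-one-off k n (n≢k ∘ cong suc)

mono-⊛ : ∀ a k f → (mono a k ⊛ f) ≈ₛ scale a (shiftⁿ k f)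
mono-⊛ a k f n = begin
  (mono a k ⊛ f) n                       ≡⟨ ⊛-cong {g = f} (mono≈ a k) (λ _ → refl) n ⟩
  (scale a (shiftⁿ k oneₛ) ⊛ f) n        ≡⟨ ⊛-scaleˡ a _ f n ⟩
  a * (shiftⁿ k oneₛ ⊛ f) n              ≡⟨ cong (a *_) (⊛-shiftⁿˡ k oneₛ f n) ⟩
  a * shiftⁿ k (oneₛ ⊛ f) n              ≡⟨ cong (a *_) (shiftⁿ-cong k (⊛-identityˡ f) n) ⟩
  a * shiftⁿ k f n                       ∎
  where open ≡-Reasoning

oneMinusU² : Series
oneMinusU² = oneₛ ⊕ mono (- + 1) 2

-- Multiplication by (1 − u²)² written with shifts: it commutes with ⊛ on either side,
-- so no associativity or commutativity of ⊛ is needed to cancel the inverse.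
infix 25 oneMinusU²Sq·_

oneMinusU²Sq·_ : Series → Series
oneMinusU²Sq· f = f ⊕ (scale (- + 2) (shiftⁿ 2 f) ⊕ shiftⁿ 4 f)

oneMinusU²Sq·-cong : ∀ {f g} → f ≈ₛ g → oneMinusU²Sq· f ≈ₛ oneMinusU²Sq· g
oneMinusU²Sq·-cong f≈g n = cong₂ _+_ (f≈g n) (cong₂ _+_ (cong (- + 2 *_) (shiftⁿ-cong 2 f≈g n)) (shiftⁿ-cong 4 f≈g n))

oneMinusU²Sq·-- : ∀ f g → oneMinusU²Sq· (λ n → f n - g n) ≈ₛ (λ n → (oneMinusU²Sq· f) n - (oneMinusU²Sq· g) n)
oneMinusU²Sq·-- f g n = begin
  f n - g n + (- + 2 * shiftⁿ 2 (λ i → f i - g i) n + shiftⁿ 4 (λ i → f i - g i) n)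
    ≡⟨ cong₂ (λ a b → f n - g n + (- + 2 * a + b)) (shiftⁿ-zipWith _-_ refl 2 f g n) (shiftⁿ-zipWith _-_ refl 4 f g n) ⟩
  f n - g n + (- + 2 * (shiftⁿ 2 f n - shiftⁿ 2 g n) + (shiftⁿ 4 f n - shiftⁿ 4 g n))
    ≡⟨ regroup (f n) (g n) (shiftⁿ 2 f n) (shiftⁿ 2 g n) (shiftⁿ 4 f n) (shiftⁿ 4 g n) ⟩
  f n + (- + 2 * shiftⁿ 2 f n + shiftⁿ 4 f n) - (g n + (- + 2 * shiftⁿ 2 g n + shiftⁿ 4 g n))
    ∎
  where
  open ≡-Reasoning
  regroup : ∀ a b c d e h → a - b + (- + 2 * (c - d) + (e - h)) ≡ a + (- + 2 * c + e) - (b + (- + 2 * d + h))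
  regroup = solve-∀

oneMinusU²Sq·-⊛ˡ : ∀ f g → (oneMinusU²Sq· f ⊛ g) ≈ₛ oneMinusU²Sq· (f ⊛ g)
oneMinusU²Sq·-⊛ˡ f g n =
  trans (⊛-distribʳ-⊕ f (f² ⊕ f⁴) g n) (cong (_+_ ((f ⊛ g) n)) (trans (⊛-distribʳ-⊕ f² f⁴ g n) (cong₂ _+_
    (trans (⊛-scaleˡ (- + 2) (shiftⁿ 2 f) g n) (cong (- + 2 *_) (⊛-shiftⁿˡ 2 f g n)))
    (⊛-shiftⁿˡ 4 f g n))))
  where
  f² f⁴ : Series
  f² = scale (- + 2) (shiftⁿ 2 f)
  f⁴ = shiftⁿ 4 f

oneMinusU²Sq·-⊛ʳ : ∀ f g → (f ⊛ oneMinusU²Sq· g) ≈ₛ oneMinusU²Sq· (f ⊛ g)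
oneMinusU²Sq·-⊛ʳ f g n =
  trans (⊛-distribˡ-⊕ f g (g² ⊕ g⁴) n) (cong (_+_ ((f ⊛ g) n)) (trans (⊛-distribˡ-⊕ f g² g⁴ n) (cong₂ _+_
    (trans (⊛-scaleʳ (- + 2) f (shiftⁿ 2 g) n) (cong (- + 2 *_) (⊛-shiftⁿʳ 2 f g n)))
    (⊛-shiftⁿʳ 4 f g n))))
  where
  g² g⁴ : Series
  g² = scale (- + 2) (shiftⁿ 2 g)
  g⁴ = shiftⁿ 4 g

oneMinusU²Sq≈ : (oneMinusU² ⊛ oneMinusU²) ≈ₛ oneMinusU²Sq· oneₛ
oneMinusU²Sq≈ n = begin
  (oneMinusU² ⊛ A) n                              ≡⟨ ⊛-distribʳ-⊕ oneₛ (mono (- + 1) 2) A n ⟩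
  (oneₛ ⊛ A) n + (mono (- + 1) 2 ⊛ A) n           ≡⟨ cong₂ _+_ (⊛-identityˡ A n) (mono-⊛ (- + 1) 2 A n) ⟩
  A n + - + 1 * shiftⁿ 2 A n                      ≡⟨ cong₂ (λ a b → a + - + 1 * b) (cong (_+_ (oneₛ n)) (mono≈ (- + 1) 2 n))
                                                                                    (shiftⁿ-zipWith _+_ refl 2 oneₛ (mono (- + 1) 2) n) ⟩
  oneₛ n + - + 1 * u² n + - + 1 * (u² n + shiftⁿ 2 (mono (- + 1) 2) n)
    ≡⟨ cong (λ b → oneₛ n + - + 1 * u² n + - + 1 * (u² n + b)) (shiftⁿ-cong 2 (mono≈ (- + 1) 2) n) ⟩
  oneₛ n + - + 1 * u² n + - + 1 * (u² n + shiftⁿ 2 (scale (- + 1) u²) n)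
    ≡⟨ cong (λ b → oneₛ n + - + 1 * u² n + - + 1 * (u² n + b)) (shiftⁿ-zipWith (λ a _ → - + 1 * a) refl 2 u² u² n) ⟩
  oneₛ n + - + 1 * u² n + - + 1 * (u² n + - + 1 * shiftⁿ 4 oneₛ n)
    ≡⟨ expand (oneₛ n) (u² n) (shiftⁿ 4 oneₛ n) ⟩
  (oneMinusU²Sq· oneₛ) n                          ∎
  where
  open ≡-Reasoning
  A u² : Series
  A  = oneMinusU²
  u² = shiftⁿ 2 oneₛ
  expand : ∀ a b c → a + - + 1 * b + - + 1 * (b + - + 1 * c) ≡ a + (- + 2 * b + c)
  expand = solve-∀

cancel-oneMinusU²Sq : ∀ inv {N B} → ((oneMinusU² ⊛ oneMinusU²) ⊛ inv) ≈ₛ oneₛ → B ≈ₛ oneMinusU²Sq· N → N ≈ₛ (inv ⊛ B)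
cancel-oneMinusU²Sq inv {N} {B} inverse B≈ = begin
  N                                    ≈⟨ ⊛-identityˡ N ⟨
  oneₛ ⊛ N                             ≈⟨ ⊛-cong inverse refl′ ⟨
  ((oneMinusU² ⊛ oneMinusU²) ⊛ inv) ⊛ N ≈⟨ ⊛-cong {g = N} (⊛-cong {g = inv} oneMinusU²Sq≈ refl′) refl′ ⟩
  (oneMinusU²Sq· oneₛ ⊛ inv) ⊛ N       ≈⟨ ⊛-cong {g = N} (oneMinusU²Sq·-⊛ˡ oneₛ inv) refl′ ⟩
  (oneMinusU²Sq· (oneₛ ⊛ inv)) ⊛ N     ≈⟨ ⊛-cong {g = N} (oneMinusU²Sq·-cong (⊛-identityˡ inv)) refl′ ⟩
  oneMinusU²Sq· inv ⊛ N                ≈⟨ oneMinusU²Sq·-⊛ˡ inv N ⟩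
  oneMinusU²Sq· (inv ⊛ N)              ≈⟨ oneMinusU²Sq·-⊛ʳ inv N ⟨
  inv ⊛ oneMinusU²Sq· N                ≈⟨ ⊛-cong {f = inv} refl′ B≈ ⟨
  inv ⊛ B                              ∎
  where
  open SeriesReasoning
  refl′ : ∀ {f : Series} → f ≈ₛ f
  refl′ _ = refl

module NonBacktracking (X : Graph) (_≟V_ : DecidableEquality (Graph.V X)) where
  open Graph X

  t-bar : ∀ e → t (bar e) ≡ o e
  t-bar e = sym (o≡tbar e)

  o-bar : ∀ e → o (bar e) ≡ t e
  o-bar e = trans (o≡tbar (bar e)) (cong t (barbar e))

  χ : V → E → ℤ
  χ v h = 𝟙 (does (t h ≟V v))

  δ : E → E → ℤ
  δ b h = 𝟙 (does (h ≟E b))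

  B : (E → ℤ) → E → ℤ
  B w h = Σ[ out (t h) ] w - w (bar h)

  B^ : ℕ → (E → ℤ) → E → ℤ
  B^ zero    w = w
  B^ (suc n) w = B^ n (B w)

  B^-suc : ∀ n w → B^ (suc n) w ≗ B (B^ n w)
  B^-suc zero    w h = refl
  B^-suc (suc n) w   = B^-suc n (B w)

  B^-cong : ∀ n {w w′} → w ≗ w′ → B^ n w ≗ B^ n w′
  B^-cong zero    w≗w′ = w≗w′
  B^-cong (suc n) w≗w′ = B^-cong n (λ h → cong₂ _-_ (sum-cong (out (t h)) w≗w′) (w≗w′ (bar h)))

  B^-0 : ∀ n → B^ n (λ _ → + 0) ≗ (λ _ → + 0)
  B^-0 zero    h = refl
  B^-0 (suc n) h = trans (B^-cong n (λ h′ → cong (_- + 0) (sum-0 (out (t h′)))) h) (B^-0 n h)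

  B^-+ : ∀ n w w′ → B^ n (λ h → w h + w′ h) ≗ (λ h → B^ n w h + B^ n w′ h)
  B^-+ zero    w w′ h = refl
  B^-+ (suc n) w w′ h = trans (B^-cong n B-+ h) (B^-+ n (B w) (B w′) h)
    where
    B-+ : B (λ h → w h + w′ h) ≗ (λ h → B w h + B w′ h)
    B-+ h = trans (cong (_- (w (bar h) + w′ (bar h))) (sum-+ (out (t h)) w w′)) (interchange (Σ[ out (t h) ] w) (Σ[ out (t h) ] w′) (w (bar h)) (w′ (bar h)))
      where
      interchange : ∀ a b c d → a + b - (c + d) ≡ (a - c) + (b - d)
      interchange = solve-∀

  B^-neg : ∀ n w → B^ n (λ h → - w h) ≗ (λ h → - B^ n w h)
  B^-neg zero    w h = refl
  B^-neg (suc n) w h = trans (B^-cong n B-neg h) (B^-neg n (B w) h)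
    where
    B-neg : B (λ h → - w h) ≗ (λ h → - B w h)
    B-neg h = trans (cong (_- (- w (bar h))) (sum-neg (out (t h)) w)) (neg-minus (Σ[ out (t h) ] w) (w (bar h)))
      where
      neg-minus : ∀ a c → - a - - c ≡ - (a - c)
      neg-minus = solve-∀

  B^-- : ∀ n w w′ → B^ n (λ h → w h - w′ h) ≗ (λ h → B^ n w h - B^ n w′ h)
  B^-- n w w′ h = trans (B^-+ n w (λ h → - w′ h) h) (cong (_+_ (B^ n w h)) (B^-neg n w′ h))

  B^-sum : ∀ {A : Set} n (L : List A) (W : A → E → ℤ) →
    B^ n (λ h → Σ[ L ] (λ a → W a h)) ≗ (λ h → Σ[ L ] (λ a → B^ n (W a) h))
  B^-sum n []      W = B^-0 n
  B^-sum n (a ∷ L) W h = trans (B^-+ n (W a) _ h) (cong (_+_ (B^ n (W a) h)) (B^-sum n L W h))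

  sum-out-select : ∀ {v} b (F : E → ℤ) → o b ≡ v → Σ[ out v ] (λ g → δ b g * F g) ≡ F b
  sum-out-select b F refl = sum-select _≟E_ (out (o b)) b F (out-unique (o b)) (out-complete b)

  sum-out-δ : ∀ v b → Σ[ out v ] (δ b) ≡ 𝟙 (does (o b ≟V v))
  sum-out-δ v b with o b ≟V v
  ... | yes o≡v = trans (sum-cong (out v) (λ g → sym (*-identityʳ (δ b g)))) (sum-out-select b (λ _ → + 1) o≡v)
  ... | no  o≢v = trans (sum-cong (out v) (λ g → sym (*-identityʳ (δ b g))))
                        (sum-select-∉ _≟E_ (out v) b (λ _ → + 1) (λ b∈out → o≢v (out-sound b∈out)))

  sum-out-remove : ∀ {v} b (F : E → ℤ) → o b ≡ v → Σ[ out v ] (λ g → F g - δ b g * F g) ≡ Σ[ out v ] F - F b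
  sum-out-remove {v} b F o≡v =
    trans (sum-- (out v) F (λ g → δ b g * F g)) (cong (_-_ (Σ[ out v ] F)) (sum-out-select b F o≡v))

  B-δ : ∀ b h → B (δ b) h ≡ χ (o b) h - δ (bar b) h
  B-δ b h = cong₂ _-_
    (trans (sum-out-δ (t h) b) (cong 𝟙 (does-⇔ (mk⇔ sym sym) (o b ≟V t h) (t h ≟V o b))))
    (cong 𝟙 (does-⇔ (mk⇔ bar-flip bar-flip′) (bar h ≟E b) (h ≟E bar b)))
    where
    bar-flip : bar h ≡ b → h ≡ bar b
    bar-flip refl = sym (barbar h)
    bar-flip′ : h ≡ bar b → bar h ≡ b
    bar-flip′ refl = barbar b

  B-δ-bar : ∀ e h → B (δ (bar e)) h ≡ χ (t e) h - δ e h
  B-δ-bar e h = trans (B-δ (bar e) h) (cong₂ (λ v b → χ v h - δ b h) (o-bar e) (barbar e))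

  sum-out-δ-bar : ∀ v h → Σ[ out v ] (λ e → δ (bar e) h) ≡ χ v h
  sum-out-δ-bar v h = begin
    Σ[ out v ] (λ e → δ (bar e) h)       ≡⟨ sum-cong (out v) (λ e → cong 𝟙 (does-⇔ (mk⇔ flip flip′) (h ≟E bar e) (e ≟E bar h))) ⟩
    Σ[ out v ] (δ (bar h))               ≡⟨ sum-out-δ v (bar h) ⟩
    𝟙 (does (o (bar h) ≟V v))            ≡⟨ cong (λ u → 𝟙 (does (u ≟V v))) (o-bar h) ⟩
    χ v h                                ∎
    where
    open ≡-Reasoning
    flip : ∀ {e} → h ≡ bar e → e ≡ bar h
    flip {e} refl = sym (barbar e)
    flip′ : ∀ {e} → e ≡ bar h → h ≡ bar e
    flip′ refl = sym (barbar h)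

  open Counting X _≟V_

  geodesic-extensions : ∀ n a (b : E → Bool) →
    Σ[ paths n (t a) ] (λ p → 𝟙 (geod (a ∷ p) ∧ b (lastE a p))) ≡ B^ n (𝟙 ∘ b) a
  geodesic-extensions zero    a b = +-identityʳ (𝟙 (b a))
  geodesic-extensions (suc n) a b = begin
    Σ[ concatMap (λ g → map (g ∷_) (paths n (t g))) (out (t a)) ] F
      ≡⟨ sum-concatMap (out (t a)) (λ g → map (g ∷_) (paths n (t g))) F ⟩
    Σ[ out (t a) ] (λ g → Σ[ map (g ∷_) (paths n (t g)) ] F)
      ≡⟨ sum-cong (out (t a)) (λ g → trans (sum-map (paths n (t g)) (g ∷_) F) (no-backtrack g)) ⟩
    Σ[ out (t a) ] (λ g → B^ n w g - δ (bar a) g * B^ n w g)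
      ≡⟨ sum-out-remove (bar a) (B^ n w) (o-bar a) ⟩
    Σ[ out (t a) ] (B^ n w) - B^ n w (bar a)
      ≡⟨ B^-suc n w a ⟨
    B^ (suc n) w a
      ∎
    where
    open ≡-Reasoning
    F : List E → ℤ
    F p = 𝟙 (geod (a ∷ p) ∧ b (lastE a p))
    w : E → ℤ
    w = 𝟙 ∘ b
    no-backtrack : ∀ g → Σ[ paths n (t g) ] (λ p → F (g ∷ p)) ≡ B^ n w g - δ (bar a) g * B^ n w g
    no-backtrack g with g ≟E bar a
    ... | yes _ = trans (sum-0 (paths n (t g))) (cancel (B^ n w g))
      where
      cancel : ∀ z → + 0 ≡ z - + 1 * z
      cancel = solve-∀
    ... | no  _ = trans (geodesic-extensions n g b) (keep (B^ n w g))
      where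
      keep : ∀ z → z ≡ z - + 0 * z
      keep = solve-∀

  count-by-first-edge : ∀ n x (P : List E → Bool) →
    + length (filterᵇ P (paths (suc n) x)) ≡ Σ[ out x ] (λ e → Σ[ paths n (t e) ] (λ p → 𝟙 (P (e ∷ p))))
  count-by-first-edge n x P =
    trans (length-filterᵇ P (paths (suc n) x))
      (trans (sum-concatMap (out x) (λ e → map (e ∷_) (paths n (t e))) (𝟙 ∘ P))
        (sum-cong (out x) (λ e → sum-map (paths n (t e)) (e ∷_) (𝟙 ∘ P))))

  endV-lastE : ∀ e p → endV (t e) p ≡ t (lastE e p)
  endV-lastE e []      = refl
  endV-lastE e (f ∷ p) = endV-lastE f p

  loops-B^ : ∀ n x → + c (suc n) x ≡ Σ[ out x ] (B^ n (χ x))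
  loops-B^ n x = trans (count-by-first-edge n x _) (sum-cong (out x) (λ e →
    trans (sum-cong (paths n (t e)) (λ p → cong 𝟙 (geodesic-first e p)))
          (geodesic-extensions n e (λ h → does (t h ≟V x)))))
    where
    geodesic-first : ∀ e p → closedAt x (e ∷ p) ∧ geod (e ∷ p) ≡ geod (e ∷ p) ∧ does (t (lastE e p) ≟V x)
    geodesic-first e p = trans (cong (λ v → does (v ≟V x) ∧ geod (e ∷ p)) (endV-lastE e p)) (∧-comm (does (t (lastE e p) ≟V x)) (geod (e ∷ p)))

  closedGeodesics-B^ : ∀ n x →
    + Ncount (suc n) x ≡ Σ[ out x ] (B^ n (χ x)) - Σ[ out x ] (λ e → B^ n (δ (bar e)) e)
  closedGeodesics-B^ n x = trans (count-by-first-edge n x _) (trans (sum-cong-∈ (out x) (λ e e∈out →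
    trans (sum-cong (paths n (t e)) (λ p → cong 𝟙 (geodesic-first e p)))
      (trans (geodesic-extensions n e (noTail e))
        (trans (B^-cong n (𝟙-noTail e (trans (t-bar e) (out-sound e∈out))) e)
          (B^-- n (χ x) (δ (bar e)) e)))))
    (sum-- (out x) (λ e → B^ n (χ x) e) (λ e → B^ n (δ (bar e)) e)))
    where
    noTail : E → E → Bool
    noTail e h = does (t h ≟V x) ∧ not (does (h ≟E bar e))
    geodesic-first : ∀ e p → closedAt x (e ∷ p) ∧ (geod (e ∷ p) ∧ not (hasTail (e ∷ p)))
                           ≡ geod (e ∷ p) ∧ noTail e (lastE e p)
    geodesic-first e p = begin
      does (endV (t e) p ≟V x) ∧ (geo ∧ untailed)   ≡⟨ cong (λ v → does (v ≟V x) ∧ (geo ∧ untailed)) (endV-lastE e p) ⟩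
      closed ∧ (geo ∧ untailed)                     ≡⟨ ∧-assoc closed geo untailed ⟨
      (closed ∧ geo) ∧ untailed                     ≡⟨ cong (_∧ untailed) (∧-comm closed geo) ⟩
      (geo ∧ closed) ∧ untailed                     ≡⟨ ∧-assoc geo closed untailed ⟩
      geo ∧ (closed ∧ untailed)                     ∎
      where
      open ≡-Reasoning
      closed geo untailed : Bool
      closed   = does (t (lastE e p) ≟V x)
      geo      = geod (e ∷ p)
      untailed = not (hasTail (e ∷ p))
    𝟙-noTail : ∀ e → t (bar e) ≡ x → ∀ h → 𝟙 (noTail e h) ≡ χ x h - δ (bar e) h
    𝟙-noTail e t≡x h with h ≟E bar e | t h ≟V x
    ... | yes refl | yes _   = refl
    ... | yes refl | no  t≢x = ⊥-elim (t≢x t≡x)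
    ... | no  _    | yes _   = refl
    ... | no  _    | no  _   = refl

  -- loops n = c_{n+1}(x) and tails n counts the geodesic loops of length n+1 at x with a tail;
  -- returns n counts, over e ∈ E_x, the geodesics of length n+1 from t e whose last edge is e.
  module AtVertex (x : V) where
    open PowerSeries X _≟V_

    d : ℤ
    d = + deg x

    loops tails neighbourLoops returns backLoops backTails : ℕ → ℤ
    loops n          = Σ[ out x ] (B^ n (χ x))
    tails n          = Σ[ out x ] (λ e → B^ n (δ (bar e)) e)
    neighbourLoops n = Σ[ out x ] (λ e → Σ[ out (t e) ] (B^ n (χ (t e))))
    returns n        = Σ[ out x ] (λ e → Σ[ out (t e) ] (B^ n (δ e)))
    backLoops n      = Σ[ out x ] (λ e → B^ n (χ x) (bar e))
    backTails n      = Σ[ out x ] (λ e → B^ n (δ (bar e)) (bar e))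

    B^-suc-bar : ∀ n w {e} → e ∈ out x → B^ (suc n) w (bar e) ≡ Σ[ out x ] (B^ n w) - B^ n w e
    B^-suc-bar n w {e} e∈out = trans (B^-suc n w (bar e))
      (cong₂ (λ v f → Σ[ out v ] (B^ n w) - B^ n w f) (trans (t-bar e) (out-sound e∈out)) (barbar e))

    sum-out-B^-δ-bar : ∀ n → Σ[ out x ] (λ e → Σ[ out x ] (B^ n (δ (bar e)))) ≡ loops n
    sum-out-B^-δ-bar n = trans (sum-swap (out x) (out x) (λ e → B^ n (δ (bar e)))) (sum-cong (out x) (λ g →
      trans (sym (B^-sum n (out x) (λ e → δ (bar e)) g)) (B^-cong n (sum-out-δ-bar x) g)))

    tails-zero : tails 0 ≡ + 0
    tails-zero = trans (sum-cong (out x) (λ e → cong 𝟙 (dec-false (e ≟E bar e) (λ e≡ē → bar≢ e (sym e≡ē)))))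
                       (sum-0 (out x))

    tails-one : tails 1 ≡ + 0
    tails-one = trans (sum-cong (out x) (λ e → trans (B-δ-bar e e)
                        (cong₂ (λ p q → 𝟙 p - 𝟙 q) (dec-true (t e ≟V t e) refl) (dec-true (e ≟E e) refl))))
                      (sum-0 (out x))

    tails-suc-suc : ∀ n → tails (suc (suc n)) ≡ neighbourLoops n - returns n - (loops n - tails n)
    tails-suc-suc n = begin
      tails (suc (suc n))
        ≡⟨ sum-cong-∈ (out x) unfold ⟩
      Σ[ out x ] (λ e → N e - Y e - (L e - T e))
        ≡⟨ trans (sum-- (out x) (λ e → N e - Y e) (λ e → L e - T e)) (cong₂ _-_ (sum-- (out x) N Y) (sum-- (out x) L T)) ⟩
      neighbourLoops n - returns n - (Σ[ out x ] L - tails n)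
        ≡⟨ cong (λ z → neighbourLoops n - returns n - (z - tails n)) (sum-out-B^-δ-bar n) ⟩
      neighbourLoops n - returns n - (loops n - tails n)
        ∎
      where
      open ≡-Reasoning
      N Y L T : E → ℤ
      N e = Σ[ out (t e) ] (B^ n (χ (t e)))
      Y e = Σ[ out (t e) ] (B^ n (δ e))
      L e = Σ[ out x ] (B^ n (δ (bar e)))
      T e = B^ n (δ (bar e)) e
      unfold : ∀ e → e ∈ out x → B^ (suc (suc n)) (δ (bar e)) e ≡ N e - Y e - (L e - T e)
      unfold e e∈out = trans (B^-suc (suc n) (δ (bar e)) e) (cong₂ _-_
        (trans (sum-cong (out (t e)) (λ g → trans (B^-cong n (B-δ-bar e) g) (B^-- n (χ (t e)) (δ e) g)))
               (sum-- (out (t e)) (B^ n (χ (t e))) (B^ n (δ e))))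
        (B^-suc-bar n (δ (bar e)) e∈out))

    returns-zero : returns 0 ≡ loops 0
    returns-zero = sum-cong-∈ (out x) (λ e e∈out → trans (sum-out-δ (t e) e)
      (cong 𝟙 (does-⇔ (mk⇔ (λ o≡t → trans (sym o≡t) (out-sound e∈out)) (λ t≡x → trans (out-sound e∈out) (sym t≡x)))
                        (o e ≟V t e) (t e ≟V x))))

    returns-loops-suc : ∀ n → returns (suc n) - loops (suc n) ≡ backLoops n - backTails n - tails (suc n)
    returns-loops-suc n = begin
      returns (suc n) - loops (suc n)                 ≡⟨ cong₂ _-_ returns-suc loops-suc ⟩
      (Z - W) - (Z - backLoops n)                     ≡⟨ regroup Z W (backLoops n) (backTails n) ⟩
      backLoops n - backTails n - (W - backTails n)   ≡⟨ cong (_-_ (backLoops n - backTails n)) tails-suc ⟨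
      backLoops n - backTails n - tails (suc n)       ∎
      where
      open ≡-Reasoning
      Z W : ℤ
      Z = Σ[ out x ] (λ e → Σ[ out (t e) ] (B^ n (χ x)))
      W = Σ[ out x ] (λ e → Σ[ out (t e) ] (B^ n (δ (bar e))))
      returns-suc : returns (suc n) ≡ Z - W
      returns-suc = trans (sum-cong-∈ (out x) (λ e e∈out → trans
          (sum-cong (out (t e)) (λ g → trans
            (B^-cong n (λ h → trans (B-δ e h) (cong (λ v → χ v h - δ (bar e) h) (out-sound e∈out))) g)
            (B^-- n (χ x) (δ (bar e)) g)))
          (sum-- (out (t e)) (B^ n (χ x)) (B^ n (δ (bar e))))))
        (sum-- (out x) _ _)
      loops-suc : loops (suc n) ≡ Z - backLoops n
      loops-suc = trans (sum-cong (out x) (B^-suc n (χ x))) (sum-- (out x) _ _)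
      tails-suc : tails (suc n) ≡ W - backTails n
      tails-suc = trans (sum-cong (out x) (λ e → B^-suc n (δ (bar e)) e)) (sum-- (out x) _ _)
      regroup : ∀ z w q v → (z - w) - (z - q) ≡ q - v - (w - v)
      regroup = solve-∀

    backLoops-zero : backLoops 0 ≡ d
    backLoops-zero = trans
      (sum-cong-∈ (out x) (λ e e∈out → cong 𝟙 (dec-true (t (bar e) ≟V x) (trans (t-bar e) (out-sound e∈out)))))
      (trans (sum-const (out x) (+ 1)) (*-identityʳ d))

    backLoops-suc : ∀ n → backLoops (suc n) ≡ d * loops n - loops n
    backLoops-suc n = trans (sum-cong-∈ (out x) (λ e → B^-suc-bar n (χ x)))
      (trans (sum-- (out x) (λ _ → loops n) (B^ n (χ x))) (cong (_- loops n) (sum-const (out x) (loops n))))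

    backTails-zero : backTails 0 ≡ d
    backTails-zero = trans (sum-cong (out x) (λ e → cong 𝟙 (dec-true (bar e ≟E bar e) refl)))
      (trans (sum-const (out x) (+ 1)) (*-identityʳ d))

    backTails-suc : ∀ n → backTails (suc n) ≡ loops n - tails n
    backTails-suc n = trans (sum-cong-∈ (out x) (λ e → B^-suc-bar n (δ (bar e))))
      (trans (sum-- (out x) (λ e → Σ[ out x ] (B^ n (δ (bar e)))) (λ e → B^ n (δ (bar e)) e))
        (cong (_- tails n) (sum-out-B^-δ-bar n)))

    tailSeries defectSeries neighbourSeries : Series
    tailSeries zero    = + 0
    tailSeries (suc n) = tails n
    defectSeries zero    = + 0
    defectSeries (suc n) = returns n - loops n
    neighbourSeries m = Σ[ out x ] (λ e → Cser (t e) m)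

    Cser-suc : ∀ n → Cser x (suc n) ≡ loops n
    Cser-suc n = loops-B^ n x

    neighbourSeries-suc : ∀ n → neighbourSeries (suc n) ≡ neighbourLoops n
    neighbourSeries-suc n = sum-cong (out x) (λ e → loops-B^ n (t e))

    Nser≈ : Nser x ≈ₛ (λ m → Cser x m - tailSeries m)
    Nser≈ zero    = refl
    Nser≈ (suc n) = trans (closedGeodesics-B^ n x) (cong (_- tails n) (sym (Cser-suc n)))

    tailSeries-step : ∀ m → tailSeries (suc (suc m)) ≡ neighbourSeries m - + 2 * Cser x m + tailSeries m - defectSeries m
    tailSeries-step zero    = trans tails-one (cong (λ z → z - + 2 * + 0 + + 0 - + 0) (sym (sum-0 (out x))))
    tailSeries-step (suc n) = begin
      tails (suc (suc n))                                                ≡⟨ tails-suc-suc n ⟩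
      neighbourLoops n - returns n - (loops n - tails n)                 ≡⟨ regroup (neighbourLoops n) (returns n) (loops n) (tails n) ⟩
      neighbourLoops n - + 2 * loops n + tails n - (returns n - loops n)
        ≡⟨ cong₂ (λ a b → a - + 2 * b + tails n - (returns n - loops n)) (neighbourSeries-suc n) (Cser-suc n) ⟨
      neighbourSeries (suc n) - + 2 * Cser x (suc n) + tails n - (returns n - loops n)   ∎
      where
      open ≡-Reasoning
      regroup : ∀ a y c r → a - y - (c - r) ≡ a - + 2 * c + r - (y - c)
      regroup = solve-∀

    defectSeries-step : ∀ m → defectSeries m ≡ (d - + 2) * shiftⁿ 2 (Cser x) m + shiftⁿ 2 tailSeries m - tailSeries m
    defectSeries-step zero = zeros d
      where
      zeros : ∀ d → + 0 ≡ (d - + 2) * + 0 + + 0 - + 0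
      zeros = solve-∀
    defectSeries-step (suc zero) = begin
      returns 0 - loops 0                  ≡⟨ cong (_- loops 0) returns-zero ⟩
      loops 0 - loops 0                    ≡⟨ cancel d (loops 0) ⟩
      (d - + 2) * + 0 + + 0 - + 0          ≡⟨ cong (_-_ ((d - + 2) * + 0 + + 0)) tails-zero ⟨
      (d - + 2) * + 0 + + 0 - tails 0      ∎
      where
      open ≡-Reasoning
      cancel : ∀ d c → c - c ≡ (d - + 2) * + 0 + + 0 - + 0
      cancel = solve-∀
    defectSeries-step (suc (suc zero)) = begin
      returns 1 - loops 1                       ≡⟨ returns-loops-suc 0 ⟩
      backLoops 0 - backTails 0 - tails 1       ≡⟨ cong₂ (λ p q → p - q - tails 1) backLoops-zero backTails-zero ⟩
      d - d - tails 1                           ≡⟨ cancel d (tails 1) ⟩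
      (d - + 2) * + 0 + + 0 - tails 1           ∎
      where
      open ≡-Reasoning
      cancel : ∀ d r → d - d - r ≡ (d - + 2) * + 0 + + 0 - r
      cancel = solve-∀
    defectSeries-step (suc (suc (suc n))) = begin
      returns (suc (suc n)) - loops (suc (suc n))          ≡⟨ returns-loops-suc (suc n) ⟩
      backLoops (suc n) - backTails (suc n) - tails (suc (suc n))
        ≡⟨ cong₂ (λ p q → p - q - tails (suc (suc n))) (backLoops-suc n) (backTails-suc n) ⟩
      d * loops n - loops n - (loops n - tails n) - tails (suc (suc n))
        ≡⟨ regroup d (loops n) (tails n) (tails (suc (suc n))) ⟩
      (d - + 2) * loops n + tails n - tails (suc (suc n))  ≡⟨ cong (λ c → (d - + 2) * c + tails n - tails (suc (suc n))) (Cser-suc n) ⟨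
      (d - + 2) * Cser x (suc n) + tails n - tails (suc (suc n))   ∎
      where
      open ≡-Reasoning
      regroup : ∀ d c r r′ → d * c - c - (c - r) - r′ ≡ (d - + 2) * c + r - r′
      regroup = solve-∀

    tailSeries-recurrence : oneMinusU²Sq· tailSeries ≈ₛ
      (λ m → shiftⁿ 2 neighbourSeries m - + 2 * shiftⁿ 2 (Cser x) m - (d - + 2) * shiftⁿ 4 (Cser x) m)
    tailSeries-recurrence zero          = zeros d
      where
      zeros : ∀ d → + 0 ≡ + 0 - + 2 * + 0 - (d - + 2) * + 0
      zeros = solve-∀
    tailSeries-recurrence (suc zero)    = trans (cong (λ r → r + (- + 2 * + 0 + + 0)) tails-zero) (zeros d)
      where
      zeros : ∀ d → + 0 + (- + 2 * + 0 + + 0) ≡ + 0 - + 2 * + 0 - (d - + 2) * + 0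
      zeros = solve-∀
    tailSeries-recurrence (suc (suc m)) = begin
      ρ (suc (suc m)) + (- + 2 * ρ m + shiftⁿ 2 ρ m)
        ≡⟨ cong (_+ (- + 2 * ρ m + shiftⁿ 2 ρ m)) (tailSeries-step m) ⟩
      neighbourSeries m - + 2 * Cser x m + ρ m - defectSeries m + (- + 2 * ρ m + shiftⁿ 2 ρ m)
        ≡⟨ cong (λ D → neighbourSeries m - + 2 * Cser x m + ρ m - D + (- + 2 * ρ m + shiftⁿ 2 ρ m)) (defectSeries-step m) ⟩
      neighbourSeries m - + 2 * Cser x m + ρ m - ((d - + 2) * shiftⁿ 2 (Cser x) m + shiftⁿ 2 ρ m - ρ m)
        + (- + 2 * ρ m + shiftⁿ 2 ρ m)
        ≡⟨ regroup (neighbourSeries m) (Cser x m) (shiftⁿ 2 (Cser x) m) (ρ m) (shiftⁿ 2 ρ m) d ⟩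
      neighbourSeries m - + 2 * Cser x m - (d - + 2) * shiftⁿ 2 (Cser x) m
        ∎
      where
      open ≡-Reasoning
      ρ : Series
      ρ = tailSeries
      regroup : ∀ p a b r r₂ d → p - + 2 * a + r - ((d - + 2) * b + r₂ - r) + (- + 2 * r + r₂) ≡ p - + 2 * a - (d - + 2) * b
      regroup = solve-∀

    bracket-shifts : Bracket x ≈ₛ
      (λ m → Cser x m + (- d * shiftⁿ 2 (Cser x) m + (d - + 1) * shiftⁿ 4 (Cser x) m) + + 1 * shiftⁿ 2 (ΔC x) m)
    bracket-shifts m = cong₂ _+_
      (trans (⊛-distribʳ-⊕ oneₛ (mono (- d) 2 ⊕ mono (d - + 1) 4) (Cser x) m) (cong₂ _+_
        (⊛-identityˡ (Cser x) m)
        (trans (⊛-distribʳ-⊕ (mono (- d) 2) (mono (d - + 1) 4) (Cser x) m)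
               (cong₂ _+_ (mono-⊛ (- d) 2 (Cser x) m) (mono-⊛ (d - + 1) 4 (Cser x) m)))))
      (mono-⊛ (+ 1) 2 (ΔC x) m)

    bracket≈ : Bracket x ≈ₛ oneMinusU²Sq· Nser x
    bracket≈ m = begin
      Bracket x m
        ≡⟨ bracket-shifts m ⟩
      γ m + (- d * γ₂ + (d - + 1) * γ₄) + + 1 * shiftⁿ 2 (ΔC x) m
        ≡⟨ cong (λ z → γ m + (- d * γ₂ + (d - + 1) * γ₄) + + 1 * z)
                (shiftⁿ-zipWith (λ u v → d * u - v) (*-zero-minus d) 2 γ neighbourSeries m) ⟩
      γ m + (- d * γ₂ + (d - + 1) * γ₄) + + 1 * (d * γ₂ - shiftⁿ 2 neighbourSeries m)
        ≡⟨ regroup (γ m) γ₂ γ₄ (shiftⁿ 2 neighbourSeries m) d ⟩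
      (oneMinusU²Sq· γ) m - (shiftⁿ 2 neighbourSeries m - + 2 * γ₂ - (d - + 2) * γ₄)
        ≡⟨ cong (_-_ ((oneMinusU²Sq· γ) m)) (tailSeries-recurrence m) ⟨
      (oneMinusU²Sq· γ) m - (oneMinusU²Sq· tailSeries) m
        ≡⟨ oneMinusU²Sq·-- γ tailSeries m ⟨
      (oneMinusU²Sq· (λ i → γ i - tailSeries i)) m
        ≡⟨ oneMinusU²Sq·-cong Nser≈ m ⟨
      (oneMinusU²Sq· Nser x) m
        ∎
      where
      open ≡-Reasoning
      γ : Series
      γ = Cser x
      γ₂ γ₄ : ℤ
      γ₂ = shiftⁿ 2 γ m
      γ₄ = shiftⁿ 4 γ m
      *-zero-minus : ∀ d → d * + 0 - + 0 ≡ + 0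
      *-zero-minus = solve-∀
      regroup : ∀ a b c p d → a + (- d * b + (d - + 1) * c) + + 1 * (d * b - p)
                            ≡ a + (- + 2 * b + c) - (p - + 2 * b - (d - + 2) * c)
      regroup = solve-∀

theorem3p1 : (X : Graph) (cnt : Countable X) → Connected X → BoundedDegree X → NoDegreeOne X →
    (x₀ : Graph.V X) →
    let open PowerSeries X (decFromInj (Σ.proj₁ cnt) (Σ.proj₂ cnt)) in
    (inv : Series) → (oneMinusU²Sq ⊛ inv) ≈ₛ oneₛ →
    Nser x₀ ≈ₛ (inv ⊛ Bracket x₀)
theorem3p1 X cnt _ _ _ x₀ inv inverse = cancel-oneMinusU²Sq inv inverse (AtVertex.bracket≈ x₀)
  where open NonBacktracking X (decFromInj (Σ.proj₁ cnt) (Σ.proj₂ cnt)) using (module AtVertex)
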